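{- For any integers $q_1,\ldots,q_d\geq2$ there are a finitely generated multiplicative submonoid $\Gamma$ of $\mathbb{Z}^+$ and a subset $A\subseteq\Gamma$ such that $(\mathbb{Z},+,q_1^{\mathbb{N}},\ldots,q_d^{\mathbb{N}})$ is a reduct of $(\mathbb{Z},+,A)$, i.e. every set definable in the former is definable in the latter.
   Context: $q^{\mathbb{N}}=\{q^n:n\in\mathbb{N}\}$. Structures of the form $(\mathbb{Z},+,A_1,\ldots)$ are expansions of $(\mathbb{Z},+)$ by unary predicates; definability is with parameters. -}

module Defs where

open import Data.Nat using (ℕ; zero; suc; _^_; _*_; _≤_; NonZero)
open import Data.Integer using (ℤ; +_) renaming (_+_ to _+ℤ_)
open import Data.Fin using (Fin; zero; suc)
open import Data.List using (List)
open import Data.List.Membership.Propositional using (_∈_)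
open import Data.Product using (Σ; ∃; _×_; _,_)
open import Data.Sum using (_⊎_)
open import Data.Empty using (⊥)
open import Function.Bundles using (_⇔_)
open import Relation.Binary.PropositionalEquality using (_≡_)

-- Formulas in a context of k free variables
-- (de Bruijn, Fin k).

-- An m-structure: (ℤ, +) expanded by m unary predicates.
Structure : ℕ → Set₁
Structure m = Fin m → ℤ → Set

data Term (k : ℕ) : Set where
  var   : Fin k → Term k
  param : ℤ → Term k                 -- parameters (definability with parameters)
  _⊕_   : Term k → Term k → Term k

data Formula (m : ℕ) : ℕ → Set where
  _≐_   : ∀ {k} → Term k → Term k → Formula m k
  rel   : ∀ {k} → Fin m → Term k → Formula m k
  ff    : ∀ {k} → Formula m k
  _∧ᶠ_  : ∀ {k} → Formula m k → Formula m k → Formula m k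
  _∨ᶠ_  : ∀ {k} → Formula m k → Formula m k → Formula m k
  _⇒ᶠ_  : ∀ {k} → Formula m k → Formula m k → Formula m k
  ∀ᶠ    : ∀ {k} → Formula m (suc k) → Formula m k
  ∃ᶠ    : ∀ {k} → Formula m (suc k) → Formula m k

Env : ℕ → Set
Env k = Fin k → ℤ

extend : ∀ {k} → ℤ → Env k → Env (suc k)
extend a ρ zero    = a
extend a ρ (suc i) = ρ i

⟦_⟧ᵗ : ∀ {k} → Term k → Env k → ℤ
⟦ var i   ⟧ᵗ ρ = ρ i
⟦ param c ⟧ᵗ ρ = c
⟦ s ⊕ t   ⟧ᵗ ρ = ⟦ s ⟧ᵗ ρ +ℤ ⟦ t ⟧ᵗ ρ

Sat : ∀ {m k} → Structure m → Formula m k → Env k → Set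
Sat M (s ≐ t)   ρ = ⟦ s ⟧ᵗ ρ ≡ ⟦ t ⟧ᵗ ρ
Sat M (rel i t) ρ = M i (⟦ t ⟧ᵗ ρ)
Sat M ff        ρ = ⊥
Sat M (φ ∧ᶠ ψ)  ρ = Sat M φ ρ × Sat M ψ ρ
Sat M (φ ∨ᶠ ψ)  ρ = Sat M φ ρ ⊎ Sat M ψ ρ
Sat M (φ ⇒ᶠ ψ)  ρ = Sat M φ ρ → Sat M ψ ρ
Sat M (∀ᶠ φ)    ρ = (a : ℤ) → Sat M φ (extend a ρ)
Sat M (∃ᶠ φ)    ρ = Σ ℤ λ a → Sat M φ (extend a ρ)

Definable : ∀ {m} → Structure m → (k : ℕ) → (Env k → Set) → Set
Definable {m} M k X = Σ (Formula m k) λ φ → ∀ ρ → X ρ ⇔ Sat M φ ρ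

IsReduct : ∀ {m₁ m₂} → Structure m₁ → Structure m₂ → Set₁
IsReduct M₁ M₂ = ∀ k (X : Env k → Set) → Definable M₁ k X → Definable M₂ k X

Powers : ℕ → ℤ → Set
Powers q x = ∃ λ n → x ≡ + (q ^ n)

PowersStructure : ∀ {d} → (Fin d → ℕ) → Structure d
PowersStructure q i = Powers (q i)

OnePredicate : (ℤ → Set) → Structure 1
OnePredicate A _ = A

data InMonoidℕ (gs : List ℕ) : ℕ → Set where
  one : InMonoidℕ gs 1
  mul : ∀ {g n} → g ∈ gs → InMonoidℕ gs n → InMonoidℕ gs (g * n)

InMonoid : List ℕ → ℤ → Set
InMonoid gs x = ∃ λ n → InMonoidℕ gs n × x ≡ + n

-- Put p = 1 + q₁⋯q_d, which is coprime to every q_i, and A = { p^i · q_i^n }.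
-- Since p divides no power of q_i, the exponent of p in an element of A
-- recovers the index i, so x ∈ q_i^ℕ iff p^i x ∈ A and p ∤ x.  Both
-- conditions are first-order in (ℤ, +, A) (multiplication by a fixed natural
-- number is iterated addition), and replacing each atom x ∈ q_i^ℕ by this
-- formula translates every formula of (ℤ, +, q₁^ℕ, …, q_d^ℕ) into an
-- equivalent one of (ℤ, +, A).
module Submission where

open import Defs
open import Data.Nat using (ℕ; _≤_)
open import Data.Integer using (ℤ)
open import Data.Fin using (Fin)
open import Data.List using (List)
open import Data.List.Relation.Unary.All using (All; _∷_)
open import Data.Product using (Σ; _×_)

open import Data.Nat as ℕ using (zero; suc; _^_; NonZero; z≤n; s≤s)
import Data.Nat.Properties as ℕ
open import Data.Nat.Divisibility
  using (_∣_; _∤_; divides; ∣-trans; ∣1⇒≡1; ∣m+n∣m⇒∣n; >⇒∤)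
open import Data.Nat.Coprimality using (Coprime; coprime-divisor)
open import Data.Nat.ListAction using (product)
open import Data.Nat.ListAction.Properties using (∈⇒∣product; product≢0)
open import Data.Integer as ℤ using (+_; -[1+_])
import Data.Integer.Properties as ℤ
import Data.Integer.Divisibility.Signed as ℤ
open import Data.Fin using (zero; suc; toℕ)
open import Data.Fin.Properties using (toℕ-injective)
open import Data.List using (_∷_; tabulate)
open import Data.List.Membership.Propositional using (_∈_)
open import Data.List.Membership.Propositional.Properties using (∈-tabulate⁺)
open import Data.List.Relation.Unary.All.Properties using (tabulate⁺)
open import Data.List.Relation.Unary.Any using (here; there)
open import Data.Product using (_,_; ∃; map₁)
open import Data.Product.Function.NonDependent.Propositional using (_×-⇔_)
open import Data.Sum.Function.Propositional using (_⊎-⇔_)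
open import Data.Empty using (⊥-elim)
open import Function.Base using (_∘_)
open import Function.Bundles using (_⇔_; mk⇔; Equivalence)
open import Function.Construct.Composition using (_⇔-∘_)
open import Function.Construct.Identity using (⇔-id)
open import Function.Related.TypeIsomorphisms using (→-cong-⇔; ¬-cong-⇔)
open import Relation.Nullary using (¬_)
open import Relation.Binary.PropositionalEquality
  using (_≡_; _≢_; refl; sym; trans; cong; cong₂; subst; module ≡-Reasoning)

private
  variable
    k m₁ m₂ : ℕ

∣⇒coprime-suc : ∀ {Q n} → n ∣ Q → Coprime (suc Q) n
∣⇒coprime-suc {Q} n∣Q {e} (e∣1+Q , e∣n) =
  ∣1⇒≡1 (∣m+n∣m⇒∣n (subst (e ∣_) (ℕ.+-comm 1 Q) e∣1+Q) (∣-trans e∣n n∣Q))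

coprime⇒∤^ : ∀ {p n} → 2 ≤ p → Coprime p n → ∀ e → p ∤ n ^ e
coprime⇒∤^ 2≤p _ zero = >⇒∤ 2≤p
coprime⇒∤^ 2≤p cop (suc e) p∣nᵉ⁺¹ = coprime⇒∤^ 2≤p cop e (coprime-divisor cop p∣nᵉ⁺¹)

p∣p^suc* : ∀ p j b → p ∣ p ^ suc j ℕ.* b
p∣p^suc* p j b = divides (p ^ j ℕ.* b) (trans (ℕ.*-assoc p (p ^ j) b) (ℕ.*-comm p _))

^*-injective : ∀ {p} .{{_ : NonZero p}} {i j a b} → p ∤ a → p ∤ b →
               p ^ i ℕ.* a ≡ p ^ j ℕ.* b → i ≡ j × a ≡ b
^*-injective {i = zero} {zero} {a} {b} _ _ eq =
  refl , trans (sym (ℕ.*-identityˡ a)) (trans eq (ℕ.*-identityˡ b))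
^*-injective {p} {zero} {suc j} {a} {b} p∤a _ eq =
  ⊥-elim (p∤a (subst (p ∣_) (trans (sym eq) (ℕ.*-identityˡ a)) (p∣p^suc* p j b)))
^*-injective {p} {suc i} {zero} {a} {b} _ p∤b eq =
  ⊥-elim (p∤b (subst (p ∣_) (trans eq (ℕ.*-identityˡ b)) (p∣p^suc* p i a)))
^*-injective {p} {suc i} {suc j} {a} {b} p∤a p∤b eq
  = map₁ (cong suc) (^*-injective p∤a p∤b (ℕ.*-cancelˡ-≡ _ _ p p^i*a≡p^j*b))
  where
  open ≡-Reasoning
  p^i*a≡p^j*b : p ℕ.* (p ^ i ℕ.* a) ≡ p ℕ.* (p ^ j ℕ.* b)
  p^i*a≡p^j*b = begin
    p ℕ.* (p ^ i ℕ.* a) ≡⟨ ℕ.*-assoc p (p ^ i) a ⟨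
    p ^ suc i ℕ.* a     ≡⟨ eq ⟩
    p ^ suc j ℕ.* b     ≡⟨ ℕ.*-assoc p (p ^ j) b ⟩
    p ℕ.* (p ^ j ℕ.* b) ∎

inMonoid-* : ∀ {gs m n} → InMonoidℕ gs m → InMonoidℕ gs n → InMonoidℕ gs (m ℕ.* n)
inMonoid-* {n = n} one ∈n = subst (InMonoidℕ _) (sym (ℕ.*-identityˡ n)) ∈n
inMonoid-* {n = n} (mul {g} {m} g∈gs ∈m) ∈n =
  subst (InMonoidℕ _) (sym (ℕ.*-assoc g m n)) (mul g∈gs (inMonoid-* ∈m ∈n))

inMonoid-^ : ∀ {gs g} → g ∈ gs → ∀ n → InMonoidℕ gs (g ^ n)
inMonoid-^ g∈gs zero    = one
inMonoid-^ g∈gs (suc n) = mul g∈gs (inMonoid-^ g∈gs n)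

+*-[1+]≢+ : ∀ c .{{_ : NonZero c}} m n → + c ℤ.* -[1+ m ] ≢ + n
+*-[1+]≢+ (suc c) m n ()

_·ᵗ_ : ℕ → Term k → Term k
zero  ·ᵗ t = param (+ 0)
suc n ·ᵗ t = t ⊕ (n ·ᵗ t)

⟦·ᵗ⟧ : ∀ n (t : Term k) ρ → ⟦ n ·ᵗ t ⟧ᵗ ρ ≡ + n ℤ.* ⟦ t ⟧ᵗ ρ
⟦·ᵗ⟧ zero    t ρ = refl
⟦·ᵗ⟧ (suc n) t ρ =
  trans (cong (λ w → ⟦ t ⟧ᵗ ρ ℤ.+ w) (⟦·ᵗ⟧ n t ρ)) (sym (ℤ.suc-* (+ n) (⟦ t ⟧ᵗ ρ)))

weakenᵗ : Term k → Term (suc k)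
weakenᵗ (var i)   = var (suc i)
weakenᵗ (param c) = param c
weakenᵗ (s ⊕ t)   = weakenᵗ s ⊕ weakenᵗ t

⟦weakenᵗ⟧ : ∀ (t : Term k) a ρ → ⟦ weakenᵗ t ⟧ᵗ (extend a ρ) ≡ ⟦ t ⟧ᵗ ρ
⟦weakenᵗ⟧ (var i)   a ρ = refl
⟦weakenᵗ⟧ (param c) a ρ = refl
⟦weakenᵗ⟧ (s ⊕ t)   a ρ = cong₂ ℤ._+_ (⟦weakenᵗ⟧ s a ρ) (⟦weakenᵗ⟧ t a ρ)

_∣ᶠ_ : ∀ {m} → ℕ → Term k → Formula m k
n ∣ᶠ t = ∃ᶠ (weakenᵗ t ≐ (n ·ᵗ var zero))

sat-∣ᶠ : ∀ {m} (M : Structure m) n (t : Term k) ρ → (+ n ℤ.∣ ⟦ t ⟧ᵗ ρ) ⇔ Sat M (n ∣ᶠ t) ρ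
sat-∣ᶠ M n t ρ = mk⇔
  (λ (ℤ.divides y eq) → y , trans (⟦weakenᵗ⟧ t y ρ) (trans eq (sym (⟦n·y⟧ y))))
  (λ (y , eq) → ℤ.divides y (trans (sym (⟦weakenᵗ⟧ t y ρ)) (trans eq (⟦n·y⟧ y))))
  where
  ⟦n·y⟧ : ∀ y → ⟦ n ·ᵗ var zero ⟧ᵗ (extend y ρ) ≡ y ℤ.* + n
  ⟦n·y⟧ y = trans (⟦·ᵗ⟧ n (var zero) (extend y ρ)) (ℤ.*-comm (+ n) y)

module _ (relDef : ∀ {k} → Fin m₁ → Term k → Formula m₂ k) where

  translate : Formula m₁ k → Formula m₂ k
  translate (s ≐ t)   = s ≐ t
  translate (rel i t) = relDef i t
  translate ff        = ff
  translate (φ ∧ᶠ ψ)  = translate φ ∧ᶠ translate ψ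
  translate (φ ∨ᶠ ψ)  = translate φ ∨ᶠ translate ψ
  translate (φ ⇒ᶠ ψ)  = translate φ ⇒ᶠ translate ψ
  translate (∀ᶠ φ)    = ∀ᶠ (translate φ)
  translate (∃ᶠ φ)    = ∃ᶠ (translate φ)

  module _ {M₁ : Structure m₁} {M₂ : Structure m₂}
           (sat-relDef : ∀ {k} i (t : Term k) ρ → M₁ i (⟦ t ⟧ᵗ ρ) ⇔ Sat M₂ (relDef i t) ρ)
           where

    sat-translate : ∀ (φ : Formula m₁ k) ρ → Sat M₁ φ ρ ⇔ Sat M₂ (translate φ) ρ
    sat-translate (s ≐ t)   ρ = ⇔-id _
    sat-translate (rel i t) ρ = sat-relDef i t ρ
    sat-translate ff        ρ = ⇔-id _
    sat-translate (φ ∧ᶠ ψ)  ρ = sat-translate φ ρ ×-⇔ sat-translate ψ ρ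
    sat-translate (φ ∨ᶠ ψ)  ρ = sat-translate φ ρ ⊎-⇔ sat-translate ψ ρ
    sat-translate (φ ⇒ᶠ ψ)  ρ = →-cong-⇔ (sat-translate φ ρ) (sat-translate ψ ρ)
    sat-translate (∀ᶠ φ)    ρ = mk⇔ (λ f a → to (sat-translate φ (extend a ρ)) (f a))
                                    (λ f a → from (sat-translate φ (extend a ρ)) (f a))
      where open Equivalence
    sat-translate (∃ᶠ φ)    ρ = mk⇔ (λ (a , s) → a , to (sat-translate φ (extend a ρ)) s)
                                    (λ (a , s) → a , from (sat-translate φ (extend a ρ)) s)
      where open Equivalence

    definableRelations⇒isReduct : IsReduct M₁ M₂
    definableRelations⇒isReduct k X (φ , X⇔φ) =
      translate φ , λ ρ → sat-translate φ ρ ⇔-∘ X⇔φ ρ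

module Construction {d} (q : Fin d → ℕ) (2≤q : ∀ i → 2 ≤ q i) where

  private
    1≤q : ∀ i → 1 ≤ q i
    1≤q i = ℕ.<⇒≤ (2≤q i)

  p : ℕ
  p = suc (product (tabulate q))

  2≤p : 2 ≤ p
  2≤p = s≤s (ℕ.>-nonZero⁻¹ _ {{product≢0 (tabulate⁺ (ℕ.>-nonZero ∘ 1≤q))}})

  p∤qⁿ : ∀ i n → p ∤ q i ^ n
  p∤qⁿ i = coprime⇒∤^ 2≤p (∣⇒coprime-suc (∈⇒∣product (∈-tabulate⁺ i)))

  generators : List ℕ
  generators = p ∷ tabulate q

  1≤generators : All (1 ≤_) generators
  1≤generators = s≤s z≤n ∷ tabulate⁺ 1≤q

  A : ℤ → Set
  A x = ∃ λ i → ∃ λ n → x ≡ + (p ^ toℕ i ℕ.* q i ^ n)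

  A⊆monoid : ∀ x → A x → InMonoid generators x
  A⊆monoid x (i , n , x≡pⁱqⁿ) =
    _ , inMonoid-* (inMonoid-^ (here refl) (toℕ i)) (inMonoid-^ (there (∈-tabulate⁺ i)) n) , x≡pⁱqⁿ

  powers⇔ : ∀ i x → Powers (q i) x ⇔ (A (+ (p ^ toℕ i) ℤ.* x) × ¬ (+ p ℤ.∣ x))
  powers⇔ i _ = mk⇔ to from
    where
    to : ∀ {x} → Powers (q i) x → A (+ (p ^ toℕ i) ℤ.* x) × ¬ (+ p ℤ.∣ x)
    to (n , refl) = (i , n , sym (ℤ.pos-* (p ^ toℕ i) (q i ^ n))) , p∤qⁿ i n ∘ ℤ.∣⇒∣ᵤ

    from : ∀ {x} → A (+ (p ^ toℕ i) ℤ.* x) × ¬ (+ p ℤ.∣ x) → Powers (q i) x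
    from { -[1+ m ] } ((_ , _ , eq) , _) =
      ⊥-elim (+*-[1+]≢+ (p ^ toℕ i) {{ℕ.m^n≢0 p (toℕ i)}} m _ eq)
    from {+ m} ((j , n , eq) , p∤m)
      with i≡j , m≡qⁿ ← ^*-injective {i = toℕ i} {toℕ j} (p∤m ∘ ℤ.∣ᵤ⇒∣) (p∤qⁿ j n)
                          (ℤ.+-injective (trans (ℤ.pos-* (p ^ toℕ i) m) eq))
      with refl ← toℕ-injective i≡j
      = n , cong +_ m≡qⁿ

  powerᶠ : Fin d → Term k → Formula 1 k
  powerᶠ i t = rel zero ((p ^ toℕ i) ·ᵗ t) ∧ᶠ ((p ∣ᶠ t) ⇒ᶠ ff)

  sat-powerᶠ : ∀ i (t : Term k) ρ → Powers (q i) (⟦ t ⟧ᵗ ρ) ⇔ Sat (OnePredicate A) (powerᶠ i t) ρ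
  sat-powerᶠ i t ρ =
    (A-cong ×-⇔ ¬-cong-⇔ (sat-∣ᶠ (OnePredicate A) p t ρ)) ⇔-∘ powers⇔ i (⟦ t ⟧ᵗ ρ)
    where
    A-cong : A (+ (p ^ toℕ i) ℤ.* ⟦ t ⟧ᵗ ρ) ⇔ A (⟦ (p ^ toℕ i) ·ᵗ t ⟧ᵗ ρ)
    A-cong = mk⇔ (subst A (sym (⟦·ᵗ⟧ (p ^ toℕ i) t ρ))) (subst A (⟦·ᵗ⟧ (p ^ toℕ i) t ρ))

lemma3p15 : (d : ℕ) (q : Fin d → ℕ) → (∀ i → 2 ≤ q i) →
    Σ (List ℕ) λ gs → All (1 ≤_) gs ×
      Σ (ℤ → Set) λ A → (∀ x → A x → InMonoid gs x) ×
        IsReduct (PowersStructure q) (OnePredicate A)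
lemma3p15 d q 2≤q =
  generators , 1≤generators , A , A⊆monoid , definableRelations⇒isReduct powerᶠ sat-powerᶠ
  where open Construction q 2≤q
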